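{- Let $\mathbf{L}=(\mathbf{A},G,H,F,P)$ be a tense DLI$^{+}$-algebra. Then $\mathrm{K}(\mathbf{L})=(\mathbf{A}_K,G_K,H_K)$ is a tense KI-algebra. Moreover, if $G(0)=0$ and $H(0)=0$, then $\mathrm{K}(\mathbf{L})$ is a tense centered KI-algebra.
   Context: A DLI-algebra is $\langle A,\wedge,\vee,\to,0,1\rangle$ with bounded distributive lattice reduct such that $(a\to b)\wedge(a\to d)=a\to(b\wedge d)$, $(a\to d)\wedge(b\to d)=(a\vee b)\to d$, $0\to a=1$, $a\to 1=1$; DLI$^{+}$ adds $a\wedge(a\to b)\le b$. A tense DLI$^{+}$-algebra is $(\mathbf{A},G,H,F,P)$ with unary operations satisfying: $P(x)\le y$ iff $x\le G(y)$; $F(x)\le y$ iff $x\le H(y)$; $G(x)\wedge F(y)\le F(x\wedge y)$, $H(x)\wedge P(y)\le P(x\wedge y)$; $G(x\vee y)\le G(x)\vee F(y)$, $H(x\vee y)\le H(x)\vee P(y)$; $G(x\to y)\le G(x)\to G(y)$, $H(x\to y)\le H(x)\to H(y)$; $G(x\to y)\le F(x)\to F(y)$, $H(x\to y)\le P(x)\to P(y)$. $\mathbf{A}_K$ is the set $K(A)=\{(a,b)\in A^2:a\wedge b=0\}$ with $(a,b)\vee(x,y)=(a\vee x,b\wedge y)$, $(a,b)\wedge(x,y)=(a\wedge x,b\vee y)$, $(a,b)\Rightarrow(x,y)=((a\to x)\wedge(y\to b),a\wedge y)$, $\sim(a,b)=(b,a)$, $0=(0,1)$, $1=(1,0)$,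 $c=(0,0)$; and $G_K(a,b)=(G(a),F(b))$, $H_K(a,b)=(H(a),P(b))$. A centered Kleene algebra is $\langle T,\wedge,\vee,\sim,c,0,1\rangle$ with bounded distributive lattice reduct, $\sim\sim x=x$, $\sim(x\vee y)=\sim x\wedge\sim y$, $x\wedge\sim x\le y\vee\sim y$, $\sim c=c$. A KI-algebra is $\langle T,\wedge,\vee,\Rightarrow,\sim,c,0,1\rangle$ with centered Kleene reduct such that $\langle T,\vee,\wedge,\Rightarrow,0,1\rangle$ is a DLI-algebra; $(x\wedge(x\Rightarrow y))\vee c\le y\vee c$; $c\Rightarrow c=1$; $(x\Rightarrow y)\wedge c=(\sim x\vee y)\wedge c$; $(x\Rightarrow\sim y)\vee c=(x\Rightarrow(\sim y\vee c))\wedge(y\Rightarrow(\sim x\vee c))$. A tense KI-algebra is $(\mathbf{T},G,H)$ with $F(x):=\sim G(\sim x)$, $P(x):=\sim H(\sim x)$, satisfying $G(1)=H(1)=1$; $G,H$ preserve $\wedge$; $x\le GP(x)$, $x\le HF(x)$; $G(x\vee y)\le G(x)\vee F(y)$, $H(x\vee y)\le H(x)\vee P(y)$; $G(x\Rightarrow y)\le G(x)\Rightarrow G(y)$, $H(x\Rightarrow y)\le H(x)\Rightarrow H(y)$; $G(x\Rightarrow y)\le F(x)\Rightarrow F(y)$, $H(x\Rightarrow y)\le P(x)\Rightarrow P(y)$. It is centered if $G(c)=c=H(c)$. -}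

module Defs where

open import Level using (Level; _⊔_) renaming (suc to lsuc)
open import Data.Product using (_×_; _,_; proj₁; proj₂)
open import Relation.Binary.Core using (Rel)
open import Relation.Binary.PropositionalEquality
  using (_≡_; refl; sym; trans; cong; cong₂; module ≡-Reasoning)
open import Algebra.Core using (Op₁; Op₂)
import Algebra.Definitions as AD
open import Algebra.Lattice.Structures using (IsDistributiveLattice)

LE : ∀ {a ℓ} {A : Set a} → Rel A ℓ → Op₂ A → A → A → Set ℓ
LE _≈_ _∧_ x y = (x ∧ y) ≈ x

record IsDLI {a ℓ} {A : Set a} (_≈_ : Rel A ℓ) (_∧_ _∨_ _⇒_ : Op₂ A) (𝟘 𝟙 : A)
       : Set (a ⊔ ℓ) where
  field
    isDistributiveLattice : IsDistributiveLattice _≈_ _∨_ _∧_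
    ∨-identity : AD.Identity _≈_ 𝟘 _∨_
    ∧-identity : AD.Identity _≈_ 𝟙 _∧_
    ⇒-cong     : AD.Congruent₂ _≈_ _⇒_
    ⇒-∧-right  : ∀ x y z → ((x ⇒ y) ∧ (x ⇒ z)) ≈ (x ⇒ (y ∧ z))
    ⇒-∨-left   : ∀ x y z → ((x ⇒ z) ∧ (y ⇒ z)) ≈ ((x ∨ y) ⇒ z)
    𝟘⇒         : ∀ x → (𝟘 ⇒ x) ≈ 𝟙
    ⇒𝟙         : ∀ x → (x ⇒ 𝟙) ≈ 𝟙
  open IsDistributiveLattice isDistributiveLattice public

record TenseDLI⁺ (a : Level) : Set (lsuc a) where
  infixr 7 _∧_
  infixr 6 _∨_
  infixr 5 _⇀_
  infix 4 _≤_
  field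
    Carrier : Set a
    _∧_ _∨_ _⇀_ : Op₂ Carrier
    𝟘 𝟙 : Carrier
    isDLI : IsDLI _≡_ _∧_ _∨_ _⇀_ 𝟘 𝟙

  _≤_ : Carrier → Carrier → Set a
  _≤_ = LE _≡_ _∧_

  field
    modusPonens : ∀ x y → x ∧ (x ⇀ y) ≤ y
    G H F P : Op₁ Carrier
    P⊣G₁ : ∀ {x y} → P x ≤ y → x ≤ G y
    P⊣G₂ : ∀ {x y} → x ≤ G y → P x ≤ y
    F⊣H₁ : ∀ {x y} → F x ≤ y → x ≤ H y
    F⊣H₂ : ∀ {x y} → x ≤ H y → F x ≤ y
    GF-∧ : ∀ x y → G x ∧ F y ≤ F (x ∧ y)
    HP-∧ : ∀ x y → H x ∧ P y ≤ P (x ∧ y)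
    GF-∨ : ∀ x y → G (x ∨ y) ≤ G x ∨ F y
    HP-∨ : ∀ x y → H (x ∨ y) ≤ H x ∨ P y
    G-⇀  : ∀ x y → G (x ⇀ y) ≤ G x ⇀ G y
    H-⇀  : ∀ x y → H (x ⇀ y) ≤ H x ⇀ H y
    GF-⇀ : ∀ x y → G (x ⇀ y) ≤ F x ⇀ F y
    HP-⇀ : ∀ x y → H (x ⇀ y) ≤ P x ⇀ P y

  open IsDLI isDLI public

record IsKI {a ℓ} {A : Set a} (_≈_ : Rel A ℓ) (_∧_ _∨_ _⇒_ : Op₂ A)
            (∼ : Op₁ A) (c 𝟘 𝟙 : A) : Set (a ⊔ ℓ) where
  _≤_ : A → A → Set ℓ
  _≤_ = LE _≈_ _∧_
  field
    isDLI : IsDLI _≈_ _∧_ _∨_ _⇒_ 𝟘 𝟙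
    ∼-cong    : AD.Congruent₁ _≈_ ∼
    ∼-involutive : ∀ x → ∼ (∼ x) ≈ x
    ∼-∨       : ∀ x y → ∼ (x ∨ y) ≈ (∼ x ∧ ∼ y)
    kleene    : ∀ x y → (x ∧ ∼ x) ≤ (y ∨ ∼ y)
    ∼c        : ∼ c ≈ c
    KI1 : ∀ x y → ((x ∧ (x ⇒ y)) ∨ c) ≤ (y ∨ c)
    KI2 : (c ⇒ c) ≈ 𝟙
    KI3 : ∀ x y → ((x ⇒ y) ∧ c) ≈ ((∼ x ∨ y) ∧ c)
    KI4 : ∀ x y → ((x ⇒ ∼ y) ∨ c) ≈ ((x ⇒ (∼ y ∨ c)) ∧ (y ⇒ (∼ x ∨ c)))

record IsTenseKI {a ℓ} {A : Set a} (_≈_ : Rel A ℓ) (_∧_ _∨_ _⇒_ : Op₂ A)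
                 (∼ : Op₁ A) (c 𝟘 𝟙 : A) (G H : Op₁ A) : Set (a ⊔ ℓ) where
  _≤_ : A → A → Set ℓ
  _≤_ = LE _≈_ _∧_
  F : Op₁ A
  F x = ∼ (G (∼ x))
  P : Op₁ A
  P x = ∼ (H (∼ x))
  field
    isKI  : IsKI _≈_ _∧_ _∨_ _⇒_ ∼ c 𝟘 𝟙
    G-cong : AD.Congruent₁ _≈_ G
    H-cong : AD.Congruent₁ _≈_ H
    G𝟙 : G 𝟙 ≈ 𝟙
    H𝟙 : H 𝟙 ≈ 𝟙
    G-∧ : ∀ x y → G (x ∧ y) ≈ (G x ∧ G y)
    H-∧ : ∀ x y → H (x ∧ y) ≈ (H x ∧ H y)
    GP  : ∀ x → x ≤ G (P x)
    HF  : ∀ x → x ≤ H (F x)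
    GF-∨ : ∀ x y → G (x ∨ y) ≤ (G x ∨ F y)
    HP-∨ : ∀ x y → H (x ∨ y) ≤ (H x ∨ P y)
    G-⇒  : ∀ x y → G (x ⇒ y) ≤ (G x ⇒ G y)
    H-⇒  : ∀ x y → H (x ⇒ y) ≤ (H x ⇒ H y)
    GF-⇒ : ∀ x y → G (x ⇒ y) ≤ (F x ⇒ F y)
    HP-⇒ : ∀ x y → H (x ⇒ y) ≤ (P x ⇒ P y)

record IsCenteredTenseKI {a ℓ} {A : Set a} (_≈_ : Rel A ℓ) (_∧_ _∨_ _⇒_ : Op₂ A)
                 (∼ : Op₁ A) (c 𝟘 𝟙 : A) (G H : Op₁ A) : Set (a ⊔ ℓ) where
  field
    isTenseKI : IsTenseKI _≈_ _∧_ _∨_ _⇒_ ∼ c 𝟘 𝟙 G H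
    Gc : G c ≈ c
    Hc : H c ≈ c

module KConstruction {a} (L : TenseDLI⁺ a) where
  open TenseDLI⁺ L hiding (sym; trans; refl)
  open ≡-Reasoning

  private
    ∧-zeroˡ : ∀ y → 𝟘 ∧ y ≡ 𝟘
    ∧-zeroˡ y = begin
      𝟘 ∧ y         ≡⟨ cong (𝟘 ∧_) (sym (proj₁ ∨-identity y)) ⟩
      𝟘 ∧ (𝟘 ∨ y)   ≡⟨ ∧-absorbs-∨ 𝟘 y ⟩
      𝟘             ∎

    ∧-zeroʳ : ∀ y → y ∧ 𝟘 ≡ 𝟘
    ∧-zeroʳ y = trans (∧-comm y 𝟘) (∧-zeroˡ y)

    interchange : ∀ p q r s → (p ∧ q) ∧ (r ∧ s) ≡ (p ∧ r) ∧ (q ∧ s)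
    interchange p q r s = begin
      (p ∧ q) ∧ (r ∧ s)   ≡⟨ ∧-assoc p q (r ∧ s) ⟩
      p ∧ (q ∧ (r ∧ s))   ≡⟨ cong (p ∧_) (sym (∧-assoc q r s)) ⟩
      p ∧ ((q ∧ r) ∧ s)   ≡⟨ cong (λ t → p ∧ (t ∧ s)) (∧-comm q r) ⟩
      p ∧ ((r ∧ q) ∧ s)   ≡⟨ cong (p ∧_) (∧-assoc r q s) ⟩
      p ∧ (r ∧ (q ∧ s))   ≡⟨ sym (∧-assoc p r (q ∧ s)) ⟩
      (p ∧ r) ∧ (q ∧ s)   ∎

    disj∨ : ∀ {a b x y} → a ∧ b ≡ 𝟘 → x ∧ y ≡ 𝟘 → (a ∨ x) ∧ (b ∧ y) ≡ 𝟘
    disj∨ {a} {b} {x} {y} ab xy = begin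
      (a ∨ x) ∧ (b ∧ y)              ≡⟨ ∧-distribʳ-∨ (b ∧ y) a x ⟩
      (a ∧ (b ∧ y)) ∨ (x ∧ (b ∧ y))  ≡⟨ cong₂ _∨_ e1 e2 ⟩
      𝟘 ∨ 𝟘                          ≡⟨ proj₁ ∨-identity 𝟘 ⟩
      𝟘                              ∎
      where
      e1 : a ∧ (b ∧ y) ≡ 𝟘
      e1 = trans (sym (∧-assoc a b y)) (trans (cong (_∧ y) ab) (∧-zeroˡ y))
      e2 : x ∧ (b ∧ y) ≡ 𝟘
      e2 = trans (cong (x ∧_) (∧-comm b y))
             (trans (sym (∧-assoc x y b)) (trans (cong (_∧ b) xy) (∧-zeroˡ b)))

    disj∧ : ∀ {a b x y} → a ∧ b ≡ 𝟘 → x ∧ y ≡ 𝟘 → (a ∧ x) ∧ (b ∨ y) ≡ 𝟘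
    disj∧ {a} {b} {x} {y} ab xy =
      trans (∧-comm (a ∧ x) (b ∨ y))
            (disj∨ (trans (∧-comm b a) ab) (trans (∧-comm y x) xy))

    disj⇒ : ∀ {a b x y} → a ∧ b ≡ 𝟘 →
            ((a ⇀ x) ∧ (y ⇀ b)) ∧ (a ∧ y) ≡ 𝟘
    disj⇒ {a} {b} {x} {y} ab = begin
      (u ∧ v) ∧ (a ∧ y)         ≡⟨ interchange u v a y ⟩
      (u ∧ a) ∧ (v ∧ y)         ≡⟨ cong ((u ∧ a) ∧_) (∧-comm v y) ⟩
      (u ∧ a) ∧ (y ∧ v)         ≡⟨ cong ((u ∧ a) ∧_) (sym (modusPonens y b)) ⟩
      (u ∧ a) ∧ ((y ∧ v) ∧ b)   ≡⟨ interchange u a (y ∧ v) b ⟩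
      (u ∧ (y ∧ v)) ∧ (a ∧ b)   ≡⟨ cong ((u ∧ (y ∧ v)) ∧_) ab ⟩
      (u ∧ (y ∧ v)) ∧ 𝟘         ≡⟨ ∧-zeroʳ _ ⟩
      𝟘                         ∎
      where
      u = a ⇀ x
      v = y ⇀ b

    F𝟘 : F 𝟘 ≡ 𝟘
    F𝟘 = trans (sym (F⊣H₂ (∧-zeroˡ (H 𝟘)))) (∧-zeroʳ (F 𝟘))

    P𝟘 : P 𝟘 ≡ 𝟘
    P𝟘 = trans (sym (P⊣G₂ (∧-zeroˡ (G 𝟘)))) (∧-zeroʳ (P 𝟘))

    disjG : ∀ {a b} → a ∧ b ≡ 𝟘 → G a ∧ F b ≡ 𝟘
    disjG {a} {b} ab = begin
      G a ∧ F b                 ≡⟨ sym (GF-∧ a b) ⟩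
      (G a ∧ F b) ∧ F (a ∧ b)   ≡⟨ cong (λ t → (G a ∧ F b) ∧ F t) ab ⟩
      (G a ∧ F b) ∧ F 𝟘         ≡⟨ cong ((G a ∧ F b) ∧_) F𝟘 ⟩
      (G a ∧ F b) ∧ 𝟘           ≡⟨ ∧-zeroʳ _ ⟩
      𝟘                         ∎

    disjH : ∀ {a b} → a ∧ b ≡ 𝟘 → H a ∧ P b ≡ 𝟘
    disjH {a} {b} ab = begin
      H a ∧ P b                 ≡⟨ sym (HP-∧ a b) ⟩
      (H a ∧ P b) ∧ P (a ∧ b)   ≡⟨ cong (λ t → (H a ∧ P b) ∧ P t) ab ⟩
      (H a ∧ P b) ∧ P 𝟘         ≡⟨ cong ((H a ∧ P b) ∧_) P𝟘 ⟩
      (H a ∧ P b) ∧ 𝟘           ≡⟨ ∧-zeroʳ _ ⟩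
      𝟘                         ∎

  record K : Set a where
    constructor ⟨_,_⟩[_]
    field
      fst  : Carrier
      snd  : Carrier
      disj : fst ∧ snd ≡ 𝟘
  open K public

  _≈K_ : Rel K a
  p ≈K q = (fst p ≡ fst q) × (snd p ≡ snd q)

  _∨K_ : Op₂ K
  ⟨ a , b ⟩[ ab ] ∨K ⟨ x , y ⟩[ xy ] = ⟨ a ∨ x , b ∧ y ⟩[ disj∨ ab xy ]

  _∧K_ : Op₂ K
  ⟨ a , b ⟩[ ab ] ∧K ⟨ x , y ⟩[ xy ] = ⟨ a ∧ x , b ∨ y ⟩[ disj∧ ab xy ]

  _⇒K_ : Op₂ K
  ⟨ a , b ⟩[ ab ] ⇒K ⟨ x , y ⟩[ xy ] =
    ⟨ (a ⇀ x) ∧ (y ⇀ b) , a ∧ y ⟩[ disj⇒ ab ]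

  ∼K : Op₁ K
  ∼K ⟨ a , b ⟩[ ab ] = ⟨ b , a ⟩[ trans (∧-comm b a) ab ]

  𝟘K : K
  𝟘K = ⟨ 𝟘 , 𝟙 ⟩[ ∧-zeroˡ 𝟙 ]

  𝟙K : K
  𝟙K = ⟨ 𝟙 , 𝟘 ⟩[ ∧-zeroʳ 𝟙 ]

  cK : K
  cK = ⟨ 𝟘 , 𝟘 ⟩[ ∧-zeroˡ 𝟘 ]

  GK : Op₁ K
  GK ⟨ a , b ⟩[ ab ] = ⟨ G a , F b ⟩[ disjG ab ]

  HK : Op₁ K
  HK ⟨ a , b ⟩[ ab ] = ⟨ H a , P b ⟩[ disjH ab ]

-- K(A) consists of the disjoint pairs (a , b), ordered upwards in a and downwards in b,
-- so every KI-axiom of K(A) splits into a DLI⁺-law for the first coordinates and a dual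
-- law for the second ones; the implication needs modus ponens, everything else only
-- the bounded distributive lattice. For the tense operators, G and H are right adjoints
-- (of P and F), hence preserve 1 and meets, while F and P are left adjoints, hence
-- preserve 0 and joins; as the second coordinate is ordered downwards, this is exactly
-- what G_K = (G , F) and H_K = (H , P) need. The remaining tense axioms of K(A) are the
-- mixed axioms of L read coordinatewise, and by the symmetry (G , F , H , P) ↦ (H , P , G , F)
-- the past axioms are the future ones. Centredness reduces to G 0 = 0 and H 0 = 0, as
-- F 0 = 0 = P 0 holds anyway.
module Submission where

open import Defs
open import Relation.Binary.PropositionalEquality using (_≡_)
open import Data.Product using (_×_)
open import Data.Product using (_,_; proj₁; proj₂)
open import Relation.Binary.PropositionalEquality using (refl; sym; trans; cong; cong₂; subst₂; isEquivalence; module ≡-Reasoning)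
open import Relation.Binary.Bundles using (Poset)
open import Relation.Binary.Definitions using (Adjoint)
open import Algebra.Core using (Op₁; Op₂)
open import Algebra.Definitions using (Congruent₁)
open import Algebra.Lattice.Bundles using (Lattice)
open import Algebra.Lattice.Structures using (IsLattice; IsDistributiveLattice)
import Algebra.Lattice.Properties.Lattice as LatticeProperties
import Algebra.Properties.CommutativeSemigroup as CommutativeSemigroupProperties
open import Algebra.Structures using (IsCommutativeBand)
import Relation.Binary.Lattice.Bundles as OrderTheoretic
import Relation.Binary.Lattice.Properties.JoinSemilattice as JoinSemilatticeProperties
import Relation.Binary.Reasoning.PartialOrder as ≤-Reasoning

module LatticeLemmas {a} {A : Set a} {_∨_ _∧_ : Op₂ A}
                     (isLattice : IsLattice _≡_ _∨_ _∧_) where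

  open IsLattice isLattice using (∨-comm)

  private
    lattice : Lattice a a
    lattice = record
      { Carrier = A ; _≈_ = _≡_ ; _∨_ = _∨_ ; _∧_ = _∧_ ; isLattice = isLattice }

    -- The library orders a lattice by x ≡ x ∧ y, the symmetric form of LE.
    module Lib = OrderTheoretic.Lattice (LatticeProperties.∨-∧-orderTheoreticLattice lattice)
    module LibJoin = JoinSemilatticeProperties Lib.joinSemilattice

  infix 4 _≤_
  _≤_ : A → A → Set a
  _≤_ = LE _≡_ _∧_

  ≤-refl : ∀ {x} → x ≤ x
  ≤-refl = sym Lib.refl

  ≤-trans : ∀ {x y z} → x ≤ y → y ≤ z → x ≤ z
  ≤-trans p q = sym (Lib.trans (sym p) (sym q))

  ≤-antisym : ∀ {x y} → x ≤ y → y ≤ x → x ≡ y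
  ≤-antisym p q = Lib.antisym (sym p) (sym q)

  ≤-poset : Poset a a a
  ≤-poset = record
    { _≈_ = _≡_
    ; _≤_ = _≤_
    ; isPartialOrder = record
      { isPreorder = record
        { isEquivalence = isEquivalence
        ; reflexive = λ { refl → ≤-refl }
        ; trans = ≤-trans
        }
      ; antisym = ≤-antisym
      }
    }

  x∧y≤x : ∀ x y → x ∧ y ≤ x
  x∧y≤x x y = sym (Lib.x∧y≤x x y)

  x∧y≤y : ∀ x y → x ∧ y ≤ y
  x∧y≤y x y = sym (Lib.x∧y≤y x y)

  ∧-greatest : ∀ {x y z} → x ≤ y → x ≤ z → x ≤ y ∧ z
  ∧-greatest p q = sym (Lib.∧-greatest (sym p) (sym q))

  ∧-mono : ∀ {x x′ y y′} → x ≤ x′ → y ≤ y′ → x ∧ y ≤ x′ ∧ y′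
  ∧-mono p q = ∧-greatest (≤-trans (x∧y≤x _ _) p) (≤-trans (x∧y≤y _ _) q)

  x≤x∨y : ∀ x y → x ≤ x ∨ y
  x≤x∨y x y = sym (Lib.x≤x∨y x y)

  y≤x∨y : ∀ x y → y ≤ x ∨ y
  y≤x∨y x y = sym (Lib.y≤x∨y x y)

  ∨-least : ∀ {x y z} → x ≤ z → y ≤ z → x ∨ y ≤ z
  ∨-least p q = sym (Lib.∨-least (sym p) (sym q))

  ∧-interchange : ∀ w x y z → (w ∧ x) ∧ (y ∧ z) ≡ (w ∧ y) ∧ (x ∧ z)
  ∧-interchange = CommutativeSemigroupProperties.interchange
    (record { isCommutativeSemigroup =
      IsCommutativeBand.isCommutativeSemigroup (LatticeProperties.∧-isSemilattice lattice) })

  y≤x⇒x∨y≡x : ∀ {x y} → y ≤ x → x ∨ y ≡ x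
  y≤x⇒x∨y≡x {x} {y} y≤x = trans (∨-comm x y) (LibJoin.x≤y⇒x∨y≈y (sym y≤x))

module GaloisConnection {a} {A : Set a} {_∨_ _∧_ : Op₂ A}
                        (isLattice : IsLattice _≡_ _∨_ _∧_)
                        {f g : Op₁ A} (f⊣g : Adjoint (LE _≡_ _∧_) (LE _≡_ _∧_) f g) where

  open LatticeLemmas isLattice

  unit : ∀ x → x ≤ g (f x)
  unit x = proj₁ f⊣g ≤-refl

  counit : ∀ y → f (g y) ≤ y
  counit y = proj₂ f⊣g ≤-refl

  f-mono : ∀ {x y} → x ≤ y → f x ≤ f y
  f-mono {y = y} x≤y = proj₂ f⊣g (≤-trans x≤y (unit y))

  g-mono : ∀ {x y} → x ≤ y → g x ≤ g y
  g-mono {x} x≤y = proj₁ f⊣g (≤-trans (counit x) x≤y)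

  g-∧ : ∀ x y → g (x ∧ y) ≡ g x ∧ g y
  g-∧ x y = ≤-antisym
    (∧-greatest (g-mono (x∧y≤x x y)) (g-mono (x∧y≤y x y)))
    (proj₁ f⊣g (∧-greatest (≤-trans (f-mono (x∧y≤x _ _)) (counit x))
                           (≤-trans (f-mono (x∧y≤y _ _)) (counit y))))

  f-∨ : ∀ x y → f (x ∨ y) ≡ f x ∨ f y
  f-∨ x y = ≤-antisym
    (proj₂ f⊣g (∨-least (≤-trans (unit x) (g-mono (x≤x∨y _ _)))
                        (≤-trans (unit y) (g-mono (y≤x∨y _ _)))))
    (∨-least (f-mono (x≤x∨y x y)) (f-mono (y≤x∨y x y)))

  g-⊤ : ∀ {⊤} → (∀ x → x ≤ ⊤) → g ⊤ ≡ ⊤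
  g-⊤ ≤⊤ = ≤-antisym (≤⊤ _) (proj₁ f⊣g (≤⊤ _))

  f-⊥ : ∀ {⊥} → (∀ x → ⊥ ≤ x) → f ⊥ ≡ ⊥
  f-⊥ ⊥≤ = ≤-antisym (proj₂ f⊣g (⊥≤ _)) (⊥≤ _)

module DLI⁺Properties {a} (L : TenseDLI⁺ a) where

  open TenseDLI⁺ L hiding (refl; sym; trans; reflexive; isEquivalence)
  open LatticeLemmas isLattice public hiding (_≤_)

  ∨-identityˡ : ∀ x → 𝟘 ∨ x ≡ x
  ∨-identityˡ = proj₁ ∨-identity

  ∨-identityʳ : ∀ x → x ∨ 𝟘 ≡ x
  ∨-identityʳ = proj₂ ∨-identity

  ∧-identityˡ : ∀ x → 𝟙 ∧ x ≡ x
  ∧-identityˡ = proj₁ ∧-identity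

  ∧-identityʳ : ∀ x → x ∧ 𝟙 ≡ x
  ∧-identityʳ = proj₂ ∧-identity

  ∧-zeroˡ : ∀ x → 𝟘 ∧ x ≡ 𝟘
  ∧-zeroˡ x = trans (cong (𝟘 ∧_) (sym (∨-identityˡ x))) (∧-absorbs-∨ 𝟘 x)

  ∧-zeroʳ : ∀ x → x ∧ 𝟘 ≡ 𝟘
  ∧-zeroʳ x = trans (∧-comm x 𝟘) (∧-zeroˡ x)

  𝟘≤ : ∀ x → 𝟘 ≤ x
  𝟘≤ = ∧-zeroˡ

  ≤𝟙 : ∀ x → x ≤ 𝟙
  ≤𝟙 = ∧-identityʳ

  ≡𝟘⇒≤ : ∀ {x y} → x ≡ 𝟘 → x ≤ y
  ≡𝟘⇒≤ refl = 𝟘≤ _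

  ∧-⇀-elim : ∀ x y z → x ∧ ((x ⇀ y) ∧ z) ≤ y
  ∧-⇀-elim x y z = begin
    x ∧ ((x ⇀ y) ∧ z)  ≡⟨ sym (∧-assoc x (x ⇀ y) z) ⟩
    (x ∧ (x ⇀ y)) ∧ z  ≤⟨ x∧y≤x _ z ⟩
    x ∧ (x ⇀ y)        ≤⟨ modusPonens x y ⟩
    y                  ∎
    where open ≤-Reasoning ≤-poset

module KIAlgebra {a} (L : TenseDLI⁺ a) where

  open TenseDLI⁺ L hiding (refl; sym; trans; reflexive; isEquivalence)
  open DLI⁺Properties L
  open KConstruction L

  infix 4 _≤K_
  _≤K_ : K → K → Set a
  _≤K_ = LE _≈K_ _∧K_

  ≤K-intro : ∀ x y → fst x ≤ fst y → snd y ≤ snd x → x ≤K y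
  ≤K-intro _ _ fst≤ snd≥ = fst≤ , y≤x⇒x∨y≡x snd≥

  isDistributiveLatticeK : IsDistributiveLattice _≈K_ _∨K_ _∧K_
  isDistributiveLatticeK = record
    { isLattice = record
      { isEquivalence = record
        { refl  = refl , refl
        ; sym   = λ { (p , q) → sym p , sym q }
        ; trans = λ { (p , q) (r , s) → trans p r , trans q s }
        }
      ; ∨-comm  = λ x y → ∨-comm (fst x) (fst y) , ∧-comm (snd x) (snd y)
      ; ∨-assoc = λ x y z → ∨-assoc (fst x) (fst y) (fst z) , ∧-assoc (snd x) (snd y) (snd z)
      ; ∨-cong  = λ { (p , q) (r , s) → cong₂ _∨_ p r , cong₂ _∧_ q s }
      ; ∧-comm  = λ x y → ∧-comm (fst x) (fst y) , ∨-comm (snd x) (snd y)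
      ; ∧-assoc = λ x y z → ∧-assoc (fst x) (fst y) (fst z) , ∨-assoc (snd x) (snd y) (snd z)
      ; ∧-cong  = λ { (p , q) (r , s) → cong₂ _∧_ p r , cong₂ _∨_ q s }
      ; absorptive =
          (λ x y → ∨-absorbs-∧ (fst x) (fst y) , ∧-absorbs-∨ (snd x) (snd y)) ,
          (λ x y → ∧-absorbs-∨ (fst x) (fst y) , ∨-absorbs-∧ (snd x) (snd y))
      }
    ; ∨-distrib-∧ =
        (λ x y z → ∨-distribˡ-∧ (fst x) (fst y) (fst z) , ∧-distribˡ-∨ (snd x) (snd y) (snd z)) ,
        (λ x y z → ∨-distribʳ-∧ (fst x) (fst y) (fst z) , ∧-distribʳ-∨ (snd x) (snd y) (snd z))
    ; ∧-distrib-∨ =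
        (λ x y z → ∧-distribˡ-∨ (fst x) (fst y) (fst z) , ∨-distribˡ-∧ (snd x) (snd y) (snd z)) ,
        (λ x y z → ∧-distribʳ-∨ (fst x) (fst y) (fst z) , ∨-distribʳ-∧ (snd x) (snd y) (snd z))
    }

  isDLIK : IsDLI _≈K_ _∧K_ _∨K_ _⇒K_ 𝟘K 𝟙K
  isDLIK = record
    { isDistributiveLattice = isDistributiveLatticeK
    ; ∨-identity =
        (λ x → ∨-identityˡ (fst x) , ∧-identityˡ (snd x)) ,
        (λ x → ∨-identityʳ (fst x) , ∧-identityʳ (snd x))
    ; ∧-identity =
        (λ x → ∧-identityˡ (fst x) , ∨-identityˡ (snd x)) ,
        (λ x → ∧-identityʳ (fst x) , ∨-identityʳ (snd x))
    ; ⇒-cong = λ { (p , q) (r , s) → cong₂ _∧_ (cong₂ _⇀_ p r) (cong₂ _⇀_ s q) , cong₂ _∧_ p s }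
    ; ⇒-∧-right = λ x y z →
        trans (∧-interchange _ _ _ _)
              (cong₂ _∧_ (⇒-∧-right (fst x) (fst y) (fst z)) (⇒-∨-left (snd y) (snd z) (snd x))) ,
        sym (∧-distribˡ-∨ (fst x) (snd y) (snd z))
    ; ⇒-∨-left = λ x y z →
        trans (∧-interchange _ _ _ _)
              (cong₂ _∧_ (⇒-∨-left (fst x) (fst y) (fst z)) (⇒-∧-right (snd z) (snd x) (snd y))) ,
        sym (∧-distribʳ-∨ (snd z) (fst x) (fst y))
    ; 𝟘⇒ = λ x → trans (cong₂ _∧_ (𝟘⇒ (fst x)) (⇒𝟙 (snd x))) (∧-identityʳ 𝟙) , ∧-zeroˡ (snd x)
    ; ⇒𝟙 = λ x → trans (cong₂ _∧_ (⇒𝟙 (fst x)) (𝟘⇒ (snd x))) (∧-identityʳ 𝟙) , ∧-zeroʳ (fst x)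
    }

  ⇀-∨𝟘-∧𝟘 : ∀ a b x y →
    ((a ⇀ (y ∨ 𝟘)) ∧ ((x ∧ 𝟘) ⇀ b)) ∧ ((x ⇀ (b ∨ 𝟘)) ∧ ((a ∧ 𝟘) ⇀ y))
      ≡ (a ⇀ y) ∧ (x ⇀ b)
  ⇀-∨𝟘-∧𝟘 a b x y = cong₂ _∧_ (simplify a y x b) (simplify x b a y)
    where
    simplify : ∀ u v w z → (u ⇀ (v ∨ 𝟘)) ∧ ((w ∧ 𝟘) ⇀ z) ≡ u ⇀ v
    simplify u v w z = begin
      (u ⇀ (v ∨ 𝟘)) ∧ ((w ∧ 𝟘) ⇀ z)  ≡⟨ cong₂ (λ s t → (u ⇀ s) ∧ (t ⇀ z)) (∨-identityʳ v) (∧-zeroʳ w) ⟩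
      (u ⇀ v) ∧ (𝟘 ⇀ z)              ≡⟨ cong ((u ⇀ v) ∧_) (𝟘⇒ z) ⟩
      (u ⇀ v) ∧ 𝟙                    ≡⟨ ∧-identityʳ (u ⇀ v) ⟩
      u ⇀ v                          ∎
      where open ≡-Reasoning

  kleeneK : ∀ x y → x ∧K ∼K x ≤K y ∨K ∼K y
  kleeneK x y = ≤K-intro (x ∧K ∼K x) (y ∨K ∼K y)
    (≡𝟘⇒≤ (disj x)) (≡𝟘⇒≤ (trans (∧-comm (snd y) (fst y)) (disj y)))

  modusPonens-modulo-cK : ∀ x y → (x ∧K (x ⇒K y)) ∨K cK ≤K y ∨K cK
  modusPonens-modulo-cK x y = ≤K-intro ((x ∧K (x ⇒K y)) ∨K cK) (y ∨K cK)
    (subst₂ _≤_ (sym (∨-identityʳ _)) (sym (∨-identityʳ _)) (∧-⇀-elim (fst x) (fst y) _))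
    (≡𝟘⇒≤ (∧-zeroʳ (snd y)))

  isKIK : IsKI _≈K_ _∧K_ _∨K_ _⇒K_ ∼K cK 𝟘K 𝟙K
  isKIK = record
    { isDLI        = isDLIK
    ; ∼-cong       = λ { (p , q) → q , p }
    ; ∼-involutive = λ _ → refl , refl
    ; ∼-∨          = λ _ _ → refl , refl
    ; kleene       = kleeneK
    ; ∼c           = refl , refl
    ; KI1          = modusPonens-modulo-cK
    ; KI2          = trans (cong₂ _∧_ (𝟘⇒ 𝟘) (𝟘⇒ 𝟘)) (∧-identityʳ 𝟙) , ∧-zeroˡ 𝟘
    ; KI3          = λ _ _ → trans (∧-zeroʳ _) (sym (∧-zeroʳ _)) , refl
    ; KI4          = λ x y →
        trans (∨-identityʳ _) (sym (⇀-∨𝟘-∧𝟘 (fst x) (snd x) (fst y) (snd y))) ,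
        trans (∧-zeroʳ _) (sym (trans (cong₂ _∨_ (∧-∧𝟘 _ _) (∧-∧𝟘 _ _)) (∨-identityʳ 𝟘)))
    }
    where
    ∧-∧𝟘 : ∀ x y → x ∧ (y ∧ 𝟘) ≡ 𝟘
    ∧-∧𝟘 x y = trans (cong (x ∧_) (∧-zeroʳ y)) (∧-zeroʳ x)

module KTense {a} (L : TenseDLI⁺ a) where

  open TenseDLI⁺ L hiding (refl; sym; trans; reflexive; isEquivalence)
  open DLI⁺Properties L
  open KConstruction L
  open KIAlgebra L

  -- (□ , ◇) stands for (G , F) or (H , P); (□⁻ , ◇⁻) is the pair of the converse direction.
  record TenseModality : Set a where
    field
      □ ◇ □⁻ ◇⁻ : Op₁ Carrier
      ◇⁻⊣□ : Adjoint _≤_ _≤_ ◇⁻ □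
      ◇⊣□⁻ : Adjoint _≤_ _≤_ ◇ □⁻
      □◇-∧ : ∀ x y → □ x ∧ ◇ y ≤ ◇ (x ∧ y)
      □◇-∨ : ∀ x y → □ (x ∨ y) ≤ □ x ∨ ◇ y
      □-⇀  : ∀ x y → □ (x ⇀ y) ≤ □ x ⇀ □ y
      □◇-⇀ : ∀ x y → □ (x ⇀ y) ≤ ◇ x ⇀ ◇ y

  future : TenseModality
  future = record
    { □ = G ; ◇ = F ; □⁻ = H ; ◇⁻ = P
    ; ◇⁻⊣□ = P⊣G₁ , P⊣G₂ ; ◇⊣□⁻ = F⊣H₁ , F⊣H₂
    ; □◇-∧ = GF-∧ ; □◇-∨ = GF-∨ ; □-⇀ = G-⇀ ; □◇-⇀ = GF-⇀
    }

  past : TenseModality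
  past = record
    { □ = H ; ◇ = P ; □⁻ = G ; ◇⁻ = F
    ; ◇⁻⊣□ = F⊣H₁ , F⊣H₂ ; ◇⊣□⁻ = P⊣G₁ , P⊣G₂
    ; □◇-∧ = HP-∧ ; □◇-∨ = HP-∨ ; □-⇀ = H-⇀ ; □◇-⇀ = HP-⇀
    }

  PreservesDisjointness : Op₁ Carrier → Op₁ Carrier → Set a
  PreservesDisjointness f g = ∀ {x y} → x ∧ y ≡ 𝟘 → f x ∧ g y ≡ 𝟘

  -- GK and HK are lift G F _ and lift H P _ up to the disjointness proof, which
  -- neither _≈K_ nor _≤K_ inspects.
  lift : (f g : Op₁ Carrier) → PreservesDisjointness f g → Op₁ K
  lift f g f∧g≡𝟘 ⟨ x , y ⟩[ x∧y≡𝟘 ] = ⟨ f x , g y ⟩[ f∧g≡𝟘 x∧y≡𝟘 ]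

  module LiftedModality (M : TenseModality) where

    open TenseModality M
    open GaloisConnection isLattice ◇⁻⊣□ using ()
      renaming (unit to ≤□◇⁻; g-∧ to □-∧; g-⊤ to □-⊤)
    open GaloisConnection isLattice ◇⊣□⁻ using ()
      renaming (counit to ◇□⁻≤; f-∨ to ◇-∨; f-⊥ to ◇-⊥)
    open ≤-Reasoning ≤-poset

    ◇□-∧ : ∀ x y → ◇ x ∧ □ y ≤ ◇ (x ∧ y)
    ◇□-∧ x y = begin
      ◇ x ∧ □ y    ≡⟨ ∧-comm (◇ x) (□ y) ⟩
      □ y ∧ ◇ x    ≤⟨ □◇-∧ y x ⟩
      ◇ (y ∧ x)    ≡⟨ cong ◇ (∧-comm y x) ⟩
      ◇ (x ∧ y)    ∎

    □◇-disjoint : PreservesDisjointness □ ◇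
    □◇-disjoint {x} {y} x∧y≡𝟘 = ≤-antisym □x∧◇y≤𝟘 (𝟘≤ _)
      where
      □x∧◇y≤𝟘 : □ x ∧ ◇ y ≤ 𝟘
      □x∧◇y≤𝟘 = begin
        □ x ∧ ◇ y    ≤⟨ □◇-∧ x y ⟩
        ◇ (x ∧ y)    ≡⟨ cong ◇ x∧y≡𝟘 ⟩
        ◇ 𝟘          ≡⟨ ◇-⊥ 𝟘≤ ⟩
        𝟘            ∎

    □K : Op₁ K
    □K = lift □ ◇ □◇-disjoint

    ◇K : Op₁ K
    ◇K x = ∼K (□K (∼K x))

    □K-cong : Congruent₁ _≈K_ □K
    □K-cong (p , q) = cong □ p , cong ◇ q

    □K-𝟙 : □K 𝟙K ≈K 𝟙K
    □K-𝟙 = □-⊤ ≤𝟙 , ◇-⊥ 𝟘≤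

    □K-cK : □ 𝟘 ≡ 𝟘 → □K cK ≈K cK
    □K-cK □𝟘≡𝟘 = □𝟘≡𝟘 , ◇-⊥ 𝟘≤

    □K-∧ : ∀ x y → □K (x ∧K y) ≈K (□K x ∧K □K y)
    □K-∧ x y = □-∧ (fst x) (fst y) , ◇-∨ (snd x) (snd y)

    □K-unit : (d : PreservesDisjointness □⁻ ◇⁻) → ∀ x → x ≤K □K (∼K (lift □⁻ ◇⁻ d (∼K x)))
    □K-unit d x = ≤K-intro x (□K (∼K (lift □⁻ ◇⁻ d (∼K x)))) (≤□◇⁻ (fst x)) (◇□⁻≤ (snd x))

    □K-∨ : ∀ x y → □K (x ∨K y) ≤K □K x ∨K ◇K y
    □K-∨ x y = ≤K-intro (□K (x ∨K y)) (□K x ∨K ◇K y)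
      (□◇-∨ (fst x) (fst y)) (◇□-∧ (snd x) (snd y))

    □-⇀-pair : ∀ a b x y → □ ((a ⇀ x) ∧ (y ⇀ b)) ≤ (□ a ⇀ □ x) ∧ (◇ y ⇀ ◇ b)
    □-⇀-pair a b x y = begin
      □ ((a ⇀ x) ∧ (y ⇀ b))        ≡⟨ □-∧ (a ⇀ x) (y ⇀ b) ⟩
      □ (a ⇀ x) ∧ □ (y ⇀ b)        ≤⟨ ∧-mono (□-⇀ a x) (□◇-⇀ y b) ⟩
      (□ a ⇀ □ x) ∧ (◇ y ⇀ ◇ b)    ∎

    □◇-⇀-pair : ∀ a b x y → □ ((a ⇀ x) ∧ (y ⇀ b)) ≤ (◇ a ⇀ ◇ x) ∧ (□ y ⇀ □ b)
    □◇-⇀-pair a b x y = begin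
      □ ((a ⇀ x) ∧ (y ⇀ b))        ≡⟨ □-∧ (a ⇀ x) (y ⇀ b) ⟩
      □ (a ⇀ x) ∧ □ (y ⇀ b)        ≤⟨ ∧-mono (□◇-⇀ a x) (□-⇀ y b) ⟩
      (◇ a ⇀ ◇ x) ∧ (□ y ⇀ □ b)    ∎

    □K-⇒ : ∀ x y → □K (x ⇒K y) ≤K □K x ⇒K □K y
    □K-⇒ x y = ≤K-intro (□K (x ⇒K y)) (□K x ⇒K □K y)
      (□-⇀-pair (fst x) (snd x) (fst y) (snd y)) (□◇-∧ (fst x) (snd y))

    □K◇K-⇒ : ∀ x y → □K (x ⇒K y) ≤K ◇K x ⇒K ◇K y
    □K◇K-⇒ x y = ≤K-intro (□K (x ⇒K y)) (◇K x ⇒K ◇K y)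
      (□◇-⇀-pair (fst x) (snd x) (fst y) (snd y)) (◇□-∧ (fst x) (snd y))

  module Future = LiftedModality future
  module Past = LiftedModality past

  isTenseKIK : IsTenseKI _≈K_ _∧K_ _∨K_ _⇒K_ ∼K cK 𝟘K 𝟙K GK HK
  isTenseKIK = record
    { isKI   = isKIK
    ; G-cong = λ {x y} → Future.□K-cong {x} {y}
    ; H-cong = λ {x y} → Past.□K-cong {x} {y}
    ; G𝟙     = Future.□K-𝟙
    ; H𝟙     = Past.□K-𝟙
    ; G-∧    = Future.□K-∧
    ; H-∧    = Past.□K-∧
    ; GP     = Future.□K-unit Past.□◇-disjoint
    ; HF     = Past.□K-unit Future.□◇-disjoint
    ; GF-∨   = Future.□K-∨
    ; HP-∨   = Past.□K-∨
    ; G-⇒    = Future.□K-⇒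
    ; H-⇒    = Past.□K-⇒
    ; GF-⇒   = Future.□K◇K-⇒
    ; HP-⇒   = Past.□K◇K-⇒
    }

  isCenteredTenseKIK : G 𝟘 ≡ 𝟘 → H 𝟘 ≡ 𝟘 →
                       IsCenteredTenseKI _≈K_ _∧K_ _∨K_ _⇒K_ ∼K cK 𝟘K 𝟙K GK HK
  isCenteredTenseKIK G𝟘≡𝟘 H𝟘≡𝟘 = record
    { isTenseKI = isTenseKIK
    ; Gc = Future.□K-cK G𝟘≡𝟘
    ; Hc = Past.□K-cK H𝟘≡𝟘
    }

lemma5p2 : ∀ {a} (L : TenseDLI⁺ a) →
    let open KConstruction L in
    IsTenseKI _≈K_ _∧K_ _∨K_ _⇒K_ ∼K cK 𝟘K 𝟙K GK HK
    × (TenseDLI⁺.G L (TenseDLI⁺.𝟘 L) ≡ TenseDLI⁺.𝟘 L →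
       TenseDLI⁺.H L (TenseDLI⁺.𝟘 L) ≡ TenseDLI⁺.𝟘 L →
       IsCenteredTenseKI _≈K_ _∧K_ _∨K_ _⇒K_ ∼K cK 𝟘K 𝟙K GK HK)
lemma5p2 L = isTenseKIK , isCenteredTenseKIK
  where open KTense L
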